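{- Let $m\geq 2$ and $n\geq 2$ be integers. Then the group $K_{n,\ldots,n}$ (with $m$ indices equal to $n$) is isomorphic to $Sym(m)$.
   Context: For positive integers $a,b$ and $1\le i\le a$, $1\le j\le b$, $E^{i,j}_{a\times b}$ denotes the $a\times b$ real matrix with entry $1$ in row $i$, column $j$ and $0$ elsewhere; $\otimes$ is the Kronecker product. For integers $k_1,\ldots,k_m\ge 2$ with product $N$ and $\rho\in Sym(m)$, the shuffling matrix is the $N\times N$ permutation matrix $$P^{\rho}_{k_1,\ldots,k_m}=\sum_{\substack{i_j=1,\ldots,k_j\\ j=1,\ldots,m}} E^{i_{\rho^{ -1}(1)},i_1}_{k_{\rho^{ -1}(1)}\times k_1}\otimes\cdots\otimes E^{i_{\rho^{ -1}(m)},i_m}_{k_{\rho^{ -1}(m)}\times k_m}.$$ Rows and columns of $N\times N$ matrices are indexed by $\{0,\ldots,N-1\}$; ${\bf e}_x$ is the column vector of length $N$ with $1$ at the position indexed by $x$. The permutation $\widetilde{\rho}$ of $\{0,\ldots,N-1\}$ induced by $P^{\rho}_{k_1,\ldots,k_m}$ is defined by $P^{\rho}_{k_1,\ldots,k_m}{\bf e}_x={\bf e}_{\widetilde{\rho}(x)}$. Define $K_{k_1,\ldots,k_m}=\langle \widetilde{\rho}:\ \rho\in Sym(m)\rangle\le Sym(\{0,\ldots,N-1\})$. -}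

module Defs where

open import Data.Nat using (ℕ; zero; suc; _*_; _≡ᵇ_)
open import Data.Nat.DivMod using (_/_; _%_)
open import Data.Bool using (Bool; true; false; if_then_else_; _∧_)
open import Data.Fin using (Fin; toℕ) renaming (zero to fzero; suc to fsuc)
open import Data.Fin.Permutation using (Permutation′; _⟨$⟩ʳ_; _⟨$⟩ˡ_; id; flip; _∘ₚ_)
open import Data.List using (List; []; _∷_; map; foldr; upTo; concatMap; allFin)
open import Data.Nat.ListAction using (sum)
open import Data.Product using (_×_; _,_; Σ; ∃)
open import Relation.Binary.PropositionalEquality using (_≡_)

-- Matrices with natural-number entries, 0-indexed: entry r s = row r, column s.
-- Dimensions are carried separately (a "sized matrix" is rows × cols × entries).

Mat : Set
Mat = ℕ → ℕ → ℕ

SMat : Set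
SMat = ℕ × ℕ × Mat

-- total quotient / remainder (the divisor is always ≥ 1 in our uses)
quo : ℕ → ℕ → ℕ
quo r zero    = zero
quo r (suc c) = r / suc c

rem : ℕ → ℕ → ℕ
rem r zero    = r
rem r (suc c) = r % suc c

E : ℕ → ℕ → ℕ → ℕ → SMat
E a b i j = a , b , λ r s → if (r ≡ᵇ i) ∧ (s ≡ᵇ j) then 1 else 0

_⊗_ : SMat → SMat → SMat
(a , b , A) ⊗ (c , d , B) =
  a * c , b * d , λ r s → A (quo r c) (quo s d) * B (rem r c) (rem s d)

I₁ : SMat
I₁ = 1 , 1 , λ r s → if (r ≡ᵇ 0) ∧ (s ≡ᵇ 0) then 1 else 0

⨂ : List SMat → SMat
⨂ = foldr _⊗_ I₁

entries : SMat → Mat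
entries (_ , _ , A) = A

-- All index tuples (i₁,…,i_m) with 0 ≤ i_j < k_j  (0-based version of 1 ≤ i_j ≤ k_j)

cons : ∀ {m} → ℕ → (Fin m → ℕ) → Fin (suc m) → ℕ
cons x f fzero    = x
cons x f (fsuc t) = f t

tuples : (m : ℕ) → (Fin m → ℕ) → List (Fin m → ℕ)
tuples zero    k = (λ ()) ∷ []
tuples (suc m) k =
  concatMap (λ x → map (cons x) (tuples m (λ t → k (fsuc t)))) (upTo (k fzero))

prod : (m : ℕ) → (Fin m → ℕ) → ℕ
prod m k = foldr _*_ 1 (map k (allFin m))

shuffling : (m : ℕ) → (k : Fin m → ℕ) → Permutation′ m → Mat
shuffling m k ρ r s =
  sum (map (λ i → entries (⨂ (map (λ t → E (k (ρ ⟨$⟩ˡ t)) (k t) (i (ρ ⟨$⟩ˡ t)) (i t))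
                                  (allFin m))) r s)
           (tuples m k))

-- σ is the permutation ρ̃ induced by P^ρ :  P^ρ e_x = e_{σ(x)} for all x,
-- i.e. column x of P^ρ is the standard basis vector e_{σ(x)}.
Induces : (m : ℕ) → (k : Fin m → ℕ) → Permutation′ m → Permutation′ (prod m k) → Set
Induces m k ρ σ = ∀ (x y : Fin (prod m k)) →
  shuffling m k ρ (toℕ y) (toℕ x) ≡ (if toℕ y ≡ᵇ toℕ (σ ⟨$⟩ʳ x) then 1 else 0)

_≈ₚ_ : ∀ {n} → Permutation′ n → Permutation′ n → Set
σ ≈ₚ τ = ∀ x → σ ⟨$⟩ʳ x ≡ τ ⟨$⟩ʳ x

data ⟨_⟩ {n : ℕ} (G : Permutation′ n → Set) : Permutation′ n → Set where
  gen  : ∀ {σ} → G σ → ⟨ G ⟩ σ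
  one  : ⟨ G ⟩ id
  mul  : ∀ {σ τ} → ⟨ G ⟩ σ → ⟨ G ⟩ τ → ⟨ G ⟩ (σ ∘ₚ τ)
  inv  : ∀ {σ} → ⟨ G ⟩ σ → ⟨ G ⟩ (flip σ)
  resp : ∀ {σ τ} → σ ≈ₚ τ → ⟨ G ⟩ σ → ⟨ G ⟩ τ

InK : (m : ℕ) → (k : Fin m → ℕ) → Permutation′ (prod m k) → Set
InK m k = ⟨ (λ σ → ∃ λ ρ → Induces m k ρ σ) ⟩

SymIso : (m : ℕ) → {N : ℕ} → (Permutation′ N → Set) → Set
SymIso m {N} H =
  Σ (Permutation′ m → Permutation′ N) λ φ →
      (∀ ρ → H (φ ρ))
    × (∀ σ → H σ → ∃ λ ρ → φ ρ ≈ₚ σ)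
    × (∀ ρ τ → φ (ρ ∘ₚ τ) ≈ₚ (φ ρ ∘ₚ φ τ))
    × (∀ ρ τ → φ ρ ≈ₚ φ τ → ρ ≈ₚ τ)

module Submission where

open import Defs
open import Data.Nat using (ℕ; zero; suc; _+_; _*_; _^_; _≤_; _<_; _≡ᵇ_; s≤s; z≤n)
open import Data.Nat.Properties
open import Data.Nat.DivMod
open import Data.Bool using (Bool; true; false; if_then_else_; _∧_; T)
open import Data.Unit using (tt)
open import Data.Fin using (Fin; toℕ; fromℕ<) renaming (zero to fzero; suc to fsuc)
open import Data.Vec.Functional using (tail)
open import Data.Fin.Properties using (toℕ-fromℕ<; toℕ-injective; toℕ<n)
open import Data.Fin.Permutation using (Permutation′; _⟨$⟩ʳ_; _⟨$⟩ˡ_; id; flip; _∘ₚ_; permutation; inverseˡ; inverseʳ)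
open import Data.List using (List; []; _∷_; map; foldr; upTo; concatMap; applyUpTo; tabulate; concat)
open import Data.List.Properties using (map-tabulate; map-cong; map-∘; map-concatMap)
open import Data.Nat.ListAction using (sum)
open import Data.Nat.ListAction.Properties using (sum-++)
open import Data.Product using (∃; _,_; proj₁; proj₂)
open import Relation.Binary.PropositionalEquality
open import Relation.Nullary using (yes; no)
open import Data.Empty using (⊥-elim)

-- Index x of the N = nᵐ basis vectors is read as an m-digit base-n numeral, digit t being
-- the index i_t of the t-th Kronecker factor.  Expanding the Kronecker product of matrix
-- units shows that the column x of P^ρ has its single 1 in the row whose digit string is
-- that of x with positions permuted by ρ⁻¹; hence ρ ↦ ρ̃ is a homomorphism onto K.  It is
-- injective because, for n ≥ 2, the numeral with a single digit 1 in position u is sent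
-- to the numeral whose digit 1 sits in position ρ(u).

χ : Bool → ℕ
χ b = if b then 1 else 0

χ-≡ : ∀ {a b} → a ≡ b → χ (a ≡ᵇ b) ≡ 1
χ-≡ {a} {b} a≡b with a ≡ᵇ b | ≡⇒≡ᵇ a b a≡b
... | true | _ = refl

χ-≢ : ∀ {a b} → a ≢ b → χ (a ≡ᵇ b) ≡ 0
χ-≢ {a} {b} a≢b with a ≡ᵇ b in eq
... | false = refl
... | true  = ⊥-elim (a≢b (≡ᵇ⇒≡ a b (subst T (sym eq) tt)))

χ≡1⇒≡ : ∀ {a b} → χ (a ≡ᵇ b) ≡ 1 → a ≡ b
χ≡1⇒≡ {a} {b} χ≡1 with a ≡ᵇ b in eq
... | true = ≡ᵇ⇒≡ a b (subst T (sym eq) tt)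

χ≤1 : ∀ b → χ b ≤ 1
χ≤1 true  = ≤-refl
χ≤1 false = z≤n

χ-∧ : ∀ p q → χ (p ∧ q) ≡ χ p * χ q
χ-∧ true  q = sym (+-identityʳ (χ q))
χ-∧ false q = refl

quo*+rem : ∀ s c → quo s c * c + rem s c ≡ s
quo*+rem s zero    = refl
quo*+rem s (suc c) = trans (+-comm (s / suc c * suc c) (s % suc c)) (sym (m≡m%n+[m/n]*n s (suc c)))

rem-*+ : ∀ x e c → e < c → rem (x * c + e) c ≡ e
rem-*+ x e (suc c) e<c = begin
  (x * suc c + e) % suc c ≡⟨ cong (_% suc c) (+-comm (x * suc c) e) ⟩
  (e + x * suc c) % suc c ≡⟨ [m+kn]%n≡m%n e x (suc c) ⟩
  e % suc c               ≡⟨ m<n⇒m%n≡m e<c ⟩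
  e                       ∎
  where open ≡-Reasoning

quo-*+ : ∀ x e c → e < c → quo (x * c + e) c ≡ x
quo-*+ x e (suc c) e<c = begin
  (x * suc c + e) / suc c         ≡⟨ +-distrib-/ (x * suc c) e remainders<c ⟩
  x * suc c / suc c + e / suc c   ≡⟨ cong₂ _+_ (m*n/n≡m x (suc c)) (m<n⇒m/n≡0 e<c) ⟩
  x + 0                           ≡⟨ +-identityʳ x ⟩
  x                               ∎
  where
  open ≡-Reasoning
  remainders<c : x * suc c % suc c + e % suc c < suc c
  remainders<c = subst (_< suc c) (sym (cong₂ _+_ (m*n%n≡0 x (suc c)) (m<n⇒m%n≡m e<c))) e<c

quo< : ∀ s c k → s < k * c → quo s c < k
quo< s zero    k s<k*0 = ⊥-elim (n≮0 (subst (s <_) (*-zeroʳ k) s<k*0))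
quo< s (suc c) k s<k*c = m<n*o⇒m/o<n s<k*c

rem< : ∀ s c k → s < k * c → rem s c < c
rem< s zero    k s<k*0 = ⊥-elim (n≮0 (subst (s <_) (*-zeroʳ k) s<k*0))
rem< s (suc c) k _     = m%n<n s (suc c)

χ-≡ᵇ-*+ : ∀ s x e c → e < c → χ (s ≡ᵇ x * c + e) ≡ χ (quo s c ≡ᵇ x) * χ (rem s c ≡ᵇ e)
χ-≡ᵇ-*+ s x e c e<c with s ≟ x * c + e
... | yes refl = trans (χ-≡ {x * c + e} refl) (sym (cong₂ _*_ (χ-≡ (quo-*+ x e c e<c)) (χ-≡ (rem-*+ x e c e<c))))
... | no s≢ with quo s c ≟ x | rem s c ≟ e
...   | yes q≡x | yes r≡e = ⊥-elim (s≢ (trans (sym (quo*+rem s c)) (cong₂ (λ u v → u * c + v) q≡x r≡e)))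
...   | no q≢x  | _       = trans (χ-≢ s≢) (sym (cong (_* χ (rem s c ≡ᵇ e)) (χ-≢ q≢x)))
...   | yes _   | no r≢e  = trans (χ-≢ s≢) (sym (trans (cong (χ (quo s c ≡ᵇ x) *_) (χ-≢ r≢e)) (*-zeroʳ (χ (quo s c ≡ᵇ x)))))

sum-concatMap : ∀ {A : Set} (f : A → List ℕ) xs → sum (concatMap f xs) ≡ sum (map (λ x → sum (f x)) xs)
sum-concatMap f []       = refl
sum-concatMap f (x ∷ xs) = trans (sum-++ (f x) (concat (map f xs))) (cong (sum (f x) +_) (sum-concatMap f xs))

sum-map-applyUpTo : ∀ (h g : ℕ → ℕ) k → sum (map h (applyUpTo g k)) ≡ sum (applyUpTo (λ x → h (g x)) k)
sum-map-applyUpTo h g zero    = refl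
sum-map-applyUpTo h g (suc k) = cong (h (g 0) +_) (sum-map-applyUpTo h (λ x → g (suc x)) k)

sum-applyUpTo-zero : ∀ k h → (∀ x → x < k → h x ≡ 0) → sum (applyUpTo h k) ≡ 0
sum-applyUpTo-zero zero    h _   = refl
sum-applyUpTo-zero (suc k) h h≡0 =
  cong₂ _+_ (h≡0 0 (s≤s z≤n)) (sum-applyUpTo-zero k (λ x → h (suc x)) (λ x x<k → h≡0 (suc x) (s≤s x<k)))

sum-applyUpTo-single : ∀ k h q → q < k → (∀ x → x < k → x ≢ q → h x ≡ 0) → sum (applyUpTo h k) ≡ h q
sum-applyUpTo-single (suc k) h zero _ h≡0 =
  trans (cong (h 0 +_) (sum-applyUpTo-zero k (λ x → h (suc x)) (λ x x<k → h≡0 (suc x) (s≤s x<k) (λ ()))))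
        (+-identityʳ (h 0))
sum-applyUpTo-single (suc k) h (suc q) (s≤s q<k) h≡0 =
  cong₂ _+_ (h≡0 0 (s≤s z≤n) (λ ()))
            (sum-applyUpTo-single k (λ x → h (suc x)) q q<k
               (λ x x<k x≢q → h≡0 (suc x) (s≤s x<k) (λ e → x≢q (suc-injective e))))

sum-tuples-suc : ∀ m (k : Fin (suc m) → ℕ) (K : (Fin (suc m) → ℕ) → ℕ) →
  sum (map K (tuples (suc m) k)) ≡
  sum (applyUpTo (λ x → sum (map (λ i → K (cons x i)) (tuples m (λ t → k (fsuc t))))) (k fzero))
sum-tuples-suc m k K = begin
  sum (map K (concatMap (λ x → map (cons x) ts) (upTo (k fzero))))
    ≡⟨ cong sum (map-concatMap K (λ x → map (cons x) ts) (upTo (k fzero))) ⟩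
  sum (concatMap (λ x → map K (map (cons x) ts)) (upTo (k fzero)))
    ≡⟨ sum-concatMap (λ x → map K (map (cons x) ts)) (upTo (k fzero)) ⟩
  sum (map (λ x → sum (map K (map (cons x) ts))) (upTo (k fzero)))
    ≡⟨ cong sum (map-cong (λ x → cong sum (sym (map-∘ ts))) (upTo (k fzero))) ⟩
  sum (map (λ x → sum (map (λ i → K (cons x i)) ts)) (upTo (k fzero)))
    ≡⟨ sum-map-applyUpTo (λ x → sum (map (λ i → K (cons x i)) ts)) (λ x → x) (k fzero) ⟩
  sum (applyUpTo (λ x → sum (map (λ i → K (cons x i)) ts)) (k fzero)) ∎
  where
  open ≡-Reasoning
  ts = tuples m (λ t → k (fsuc t))

flip-cong : ∀ {N} {π π′ : Permutation′ N} → π ≈ₚ π′ → flip π ≈ₚ flip π′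
flip-cong {π = π} {π′} π≈π′ x = begin
  π ⟨$⟩ˡ x                      ≡⟨ inverseˡ π′ ⟨
  π′ ⟨$⟩ˡ (π′ ⟨$⟩ʳ (π ⟨$⟩ˡ x))  ≡⟨ cong (π′ ⟨$⟩ˡ_) (π≈π′ _) ⟨
  π′ ⟨$⟩ˡ (π ⟨$⟩ʳ (π ⟨$⟩ˡ x))   ≡⟨ cong (π′ ⟨$⟩ˡ_) (inverseʳ π) ⟩
  π′ ⟨$⟩ˡ x                     ∎
  where open ≡-Reasoning

module Radix (n : ℕ) where

  Bounded : ∀ {m} → (Fin m → ℕ) → Set
  Bounded i = ∀ t → i t < n

  encode : ∀ m → (Fin m → ℕ) → ℕ
  encode zero    i = 0
  encode (suc m) i = i fzero * n ^ m + encode m (tail i)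

  digits : ∀ m → ℕ → Fin m → ℕ
  digits zero    s = λ ()
  digits (suc m) s = cons (quo s (n ^ m)) (digits m (rem s (n ^ m)))

  encode-cong : ∀ m {i j : Fin m → ℕ} → (∀ t → i t ≡ j t) → encode m i ≡ encode m j
  encode-cong zero    i≗j = refl
  encode-cong (suc m) i≗j = cong₂ (λ u v → u * n ^ m + v) (i≗j fzero) (encode-cong m (λ t → i≗j (fsuc t)))

  encode< : ∀ m i → Bounded i → encode m i < n ^ m
  encode< zero    i _   = s≤s z≤n
  encode< (suc m) i i<n = begin-strict
    i fzero * n ^ m + encode m (tail i) <⟨ +-monoʳ-< (i fzero * n ^ m) (encode< m (tail i) (λ t → i<n (fsuc t))) ⟩
    i fzero * n ^ m + n ^ m             ≡⟨ +-comm (i fzero * n ^ m) (n ^ m) ⟩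
    suc (i fzero) * n ^ m               ≤⟨ *-monoˡ-≤ (n ^ m) (i<n fzero) ⟩
    n * n ^ m                           ∎
    where open ≤-Reasoning

  digits-encode : ∀ m i → Bounded i → ∀ t → digits m (encode m i) t ≡ i t
  digits-encode (suc m) i i<n fzero    = quo-*+ (i fzero) _ (n ^ m) (encode< m (tail i) (λ t → i<n (fsuc t)))
  digits-encode (suc m) i i<n (fsuc t) =
    trans (cong (λ v → digits m v t) (rem-*+ (i fzero) _ (n ^ m) (encode< m (tail i) (λ t → i<n (fsuc t)))))
          (digits-encode m (tail i) (λ t → i<n (fsuc t)) t)

  encode-digits : ∀ m s → s < n ^ m → encode m (digits m s) ≡ s
  encode-digits zero    zero    _           = refl
  encode-digits zero    (suc s) (s≤s ())
  encode-digits (suc m) s       s<n^[1+m] =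
    trans (cong (quo s (n ^ m) * n ^ m +_) (encode-digits m (rem s (n ^ m)) (rem< s (n ^ m) n s<n^[1+m])))
          (quo*+rem s (n ^ m))

  digits-bounded : ∀ m s → s < n ^ m → Bounded (digits m s)
  digits-bounded (suc m) s s<n^[1+m] fzero    = quo< s (n ^ m) n s<n^[1+m]
  digits-bounded (suc m) s s<n^[1+m] (fsuc t) = digits-bounded m (rem s (n ^ m)) (rem< s (n ^ m) n s<n^[1+m]) t

  permuteDigits : ∀ m → (Fin m → Fin m) → ℕ → ℕ
  permuteDigits m π s = encode m (λ t → digits m s (π t))

  permuteDigits< : ∀ m π s → s < n ^ m → permuteDigits m π s < n ^ m
  permuteDigits< m π s s< = encode< m _ (λ t → digits-bounded m s s< (π t))

  digits-permuteDigits : ∀ m π s → s < n ^ m → ∀ t → digits m (permuteDigits m π s) t ≡ digits m s (π t)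
  digits-permuteDigits m π s s< = digits-encode m _ (λ t → digits-bounded m s s< (π t))

  permuteDigits-∘ : ∀ m π₁ π₂ s → s < n ^ m →
                    permuteDigits m π₁ (permuteDigits m π₂ s) ≡ permuteDigits m (λ t → π₂ (π₁ t)) s
  permuteDigits-∘ m π₁ π₂ s s< = encode-cong m (λ t → digits-permuteDigits m π₂ s s< (π₁ t))

  permuteDigits-id : ∀ m π s → (∀ t → π t ≡ t) → s < n ^ m → permuteDigits m π s ≡ s
  permuteDigits-id m π s π≗id s< = trans (encode-cong m (λ t → cong (digits m s) (π≗id t))) (encode-digits m s s<)

  Units : ∀ m → (Fin m → ℕ) → (Fin m → ℕ) → SMat
  Units m i j = ⨂ (tabulate (λ t → E n n (i t) (j t)))

  Units-rows : ∀ m i j → proj₁ (Units m i j) ≡ n ^ m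
  Units-rows zero    i j = refl
  Units-rows (suc m) i j = cong (n *_) (Units-rows m (tail i) (tail j))

  Units-cols : ∀ m i j → proj₁ (proj₂ (Units m i j)) ≡ n ^ m
  Units-cols zero    i j = refl
  Units-cols (suc m) i j = cong (n *_) (Units-cols m (tail i) (tail j))

  entries-Units : ∀ m i j → Bounded i → Bounded j → ∀ r s →
    entries (Units m i j) r s ≡ χ (r ≡ᵇ encode m i) * χ (s ≡ᵇ encode m j)
  entries-Units zero    i j _   _   r s = χ-∧ (r ≡ᵇ 0) (s ≡ᵇ 0)
  entries-Units (suc m) i j i<n j<n r s = begin
    entries (X ⊗ Y) r s
      ≡⟨ cong₂ (λ u v → entries X (quo r u) (quo s v) * entries Y (rem r u) (rem s v))
               (Units-rows m (tail i) (tail j)) (Units-cols m (tail i) (tail j)) ⟩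
    entries X (quo r c) (quo s c) * entries Y (rem r c) (rem s c)
      ≡⟨ cong₂ _*_ (χ-∧ (quo r c ≡ᵇ i fzero) (quo s c ≡ᵇ j fzero))
                   (entries-Units m (tail i) (tail j) (λ t → i<n (fsuc t)) (λ t → j<n (fsuc t)) (rem r c) (rem s c)) ⟩
    (χ (quo r c ≡ᵇ i fzero) * χ (quo s c ≡ᵇ j fzero)) * (χ (rem r c ≡ᵇ i′) * χ (rem s c ≡ᵇ j′))
      ≡⟨ [m*n]*[o*p]≡[m*o]*[n*p] (χ (quo r c ≡ᵇ i fzero)) _ _ _ ⟩
    (χ (quo r c ≡ᵇ i fzero) * χ (rem r c ≡ᵇ i′)) * (χ (quo s c ≡ᵇ j fzero) * χ (rem s c ≡ᵇ j′))
      ≡⟨ sym (cong₂ _*_ (χ-≡ᵇ-*+ r (i fzero) i′ c (encode< m (tail i) (λ t → i<n (fsuc t))))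
                        (χ-≡ᵇ-*+ s (j fzero) j′ c (encode< m (tail j) (λ t → j<n (fsuc t))))) ⟩
    χ (r ≡ᵇ encode (suc m) i) * χ (s ≡ᵇ encode (suc m) j) ∎
    where
    open ≡-Reasoning
    c = n ^ m
    i′ = encode m (tail i)
    j′ = encode m (tail j)
    X = E n n (i fzero) (j fzero)
    Y = Units m (tail i) (tail j)

  -- f must respect pointwise equality since functions are compared without funext.
  sum-tuples-χ : ∀ m (K f : (Fin m → ℕ) → ℕ) s → s < n ^ m →
    (∀ i j → (∀ t → i t ≡ j t) → f i ≡ f j) →
    (∀ i → Bounded i → K i ≡ f i * χ (s ≡ᵇ encode m i)) →
    sum (map K (tuples m (λ _ → n))) ≡ f (digits m s)
  sum-tuples-χ zero K f zero _ f-cong K≡ = begin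
    K (λ ()) + 0   ≡⟨ +-identityʳ _ ⟩
    K (λ ())       ≡⟨ K≡ (λ ()) (λ ()) ⟩
    f (λ ()) * 1   ≡⟨ *-identityʳ _ ⟩
    f (λ ())       ≡⟨ f-cong _ _ (λ ()) ⟩
    f (digits zero zero) ∎
    where open ≡-Reasoning
  sum-tuples-χ zero K f (suc s) (s≤s ()) _ _
  sum-tuples-χ (suc m) K f s s< f-cong K≡ = begin
    sum (map K (tuples (suc m) (λ _ → n))) ≡⟨ sum-tuples-suc m (λ _ → n) K ⟩
    sum (applyUpTo h n)                    ≡⟨ sum-applyUpTo-single n h q q<n h-off ⟩
    h q                                    ≡⟨ h≡ q q<n ⟩
    f (cons q rest) * χ (q ≡ᵇ q)           ≡⟨ cong (f (cons q rest) *_) (χ-≡ {q} refl) ⟩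
    f (cons q rest) * 1                    ≡⟨ *-identityʳ _ ⟩
    f (digits (suc m) s)                   ∎
    where
    open ≡-Reasoning
    c = n ^ m
    q = quo s c
    q<n = quo< s c n s<
    rest = digits m (rem s c)
    h : ℕ → ℕ
    h x = sum (map (λ i → K (cons x i)) (tuples m (λ _ → n)))
    h≡ : ∀ x → x < n → h x ≡ f (cons x rest) * χ (q ≡ᵇ x)
    h≡ x x<n = sum-tuples-χ m (λ i → K (cons x i)) (λ i → f (cons x i) * χ (q ≡ᵇ x)) (rem s c) (rem< s c n s<)
      (λ i j i≗j → cong (_* χ (q ≡ᵇ x)) (f-cong (cons x i) (cons x j) λ { fzero → refl ; (fsuc t) → i≗j t }))
      (λ i i<n → trans (K≡ (cons x i) λ { fzero → x<n ; (fsuc t) → i<n t })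
                  (trans (cong (f (cons x i) *_) (χ-≡ᵇ-*+ s x (encode m i) c (encode< m i i<n)))
                         (sym (*-assoc (f (cons x i)) _ _))))
    h-off : ∀ x → x < n → x ≢ q → h x ≡ 0
    h-off x x<n x≢q = trans (h≡ x x<n) (trans (cong (f (cons x rest) *_) (χ-≢ (λ q≡x → x≢q (sym q≡x)))) (*-zeroʳ (f (cons x rest))))

  shuffling-entry : ∀ m (ρ : Permutation′ m) r s → s < n ^ m →
                    shuffling m (λ _ → n) ρ r s ≡ χ (r ≡ᵇ permuteDigits m (ρ ⟨$⟩ˡ_) s)
  shuffling-entry m ρ r s s< = sum-tuples-χ m _ (λ i → χ (r ≡ᵇ encode m (λ t → i (ρ ⟨$⟩ˡ t)))) s s<
    (λ i j i≗j → cong (λ v → χ (r ≡ᵇ v)) (encode-cong m (λ t → i≗j (ρ ⟨$⟩ˡ t))))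
    (λ i i<n → trans (cong (λ L → entries (⨂ L) r s) (map-tabulate (λ t → t) (λ t → E n n (i (ρ ⟨$⟩ˡ t)) (i t))))
                     (entries-Units m (λ t → i (ρ ⟨$⟩ˡ t)) i (λ t → i<n (ρ ⟨$⟩ˡ t)) i<n r s))

  prod-const : ∀ m → prod m (λ _ → n) ≡ n ^ m
  prod-const m = trans (cong (foldr _*_ 1) (map-tabulate {n = m} (λ t → t) (λ _ → n))) (foldr-const m)
    where
    foldr-const : ∀ m → foldr _*_ 1 (tabulate {n = m} (λ _ → n)) ≡ n ^ m
    foldr-const zero    = refl
    foldr-const (suc m) = cong (n *_) (foldr-const m)

  module Shuffle (m : ℕ) where

    N : ℕ
    N = prod m (λ _ → n)

    toℕ<n^m : (x : Fin N) → toℕ x < n ^ m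
    toℕ<n^m x = subst (toℕ x <_) (prod-const m) (toℕ<n x)

    index : (v : ℕ) → v < n ^ m → Fin N
    index v v< = fromℕ< (subst (v <_) (sym (prod-const m)) v<)

    toℕ-index : ∀ v v< → toℕ (index v v<) ≡ v
    toℕ-index v v< = toℕ-fromℕ< (subst (v <_) (sym (prod-const m)) v<)

    permuteIndex : (Fin m → Fin m) → Fin N → Fin N
    permuteIndex π x = index (permuteDigits m π (toℕ x)) (permuteDigits< m π (toℕ x) (toℕ<n^m x))

    toℕ-permuteIndex : ∀ π x → toℕ (permuteIndex π x) ≡ permuteDigits m π (toℕ x)
    toℕ-permuteIndex π x = toℕ-index _ (permuteDigits< m π (toℕ x) (toℕ<n^m x))

    permuteIndex-inverse : ∀ π₁ π₂ → (∀ t → π₂ (π₁ t) ≡ t) → ∀ x → permuteIndex π₁ (permuteIndex π₂ x) ≡ x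
    permuteIndex-inverse π₁ π₂ π₂∘π₁≗id x = toℕ-injective (begin
      toℕ (permuteIndex π₁ (permuteIndex π₂ x))       ≡⟨ toℕ-permuteIndex π₁ _ ⟩
      permuteDigits m π₁ (toℕ (permuteIndex π₂ x))    ≡⟨ cong (permuteDigits m π₁) (toℕ-permuteIndex π₂ x) ⟩
      permuteDigits m π₁ (permuteDigits m π₂ (toℕ x)) ≡⟨ permuteDigits-∘ m π₁ π₂ (toℕ x) (toℕ<n^m x) ⟩
      permuteDigits m (λ t → π₂ (π₁ t)) (toℕ x)       ≡⟨ permuteDigits-id m _ (toℕ x) π₂∘π₁≗id (toℕ<n^m x) ⟩
      toℕ x                                           ∎)
      where open ≡-Reasoning

    shuffle : Permutation′ m → Permutation′ N
    shuffle ρ = permutation (permuteIndex (ρ ⟨$⟩ˡ_)) (permuteIndex (ρ ⟨$⟩ʳ_))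
      (permuteIndex-inverse (ρ ⟨$⟩ˡ_) (ρ ⟨$⟩ʳ_) (λ _ → inverseʳ ρ))
      (permuteIndex-inverse (ρ ⟨$⟩ʳ_) (ρ ⟨$⟩ˡ_) (λ _ → inverseˡ ρ))

    shuffle-induced : ∀ ρ → Induces m (λ _ → n) ρ (shuffle ρ)
    shuffle-induced ρ x y = trans (shuffling-entry m ρ (toℕ y) (toℕ x) (toℕ<n^m x))
                                  (cong (λ v → χ (toℕ y ≡ᵇ v)) (sym (toℕ-permuteIndex (ρ ⟨$⟩ˡ_) x)))

    induced≈shuffle : ∀ ρ σ → Induces m (λ _ → n) ρ σ → shuffle ρ ≈ₚ σ
    induced≈shuffle ρ σ σ-induced x = toℕ-injective (χ≡1⇒≡ (begin
      χ (toℕ y ≡ᵇ toℕ (σ ⟨$⟩ʳ x)) ≡⟨ σ-induced x y ⟨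
      shuffling m (λ _ → n) ρ (toℕ y) (toℕ x) ≡⟨ shuffle-induced ρ x y ⟩
      χ (toℕ y ≡ᵇ toℕ y) ≡⟨ χ-≡ {toℕ y} refl ⟩
      1 ∎))
      where
      open ≡-Reasoning
      y = shuffle ρ ⟨$⟩ʳ x

    shuffle-∘ : ∀ ρ τ → shuffle (ρ ∘ₚ τ) ≈ₚ (shuffle ρ ∘ₚ shuffle τ)
    shuffle-∘ ρ τ x = toℕ-injective (begin
      toℕ (permuteIndex ((ρ ∘ₚ τ) ⟨$⟩ˡ_) x)                   ≡⟨ toℕ-permuteIndex _ x ⟩
      permuteDigits m ((ρ ∘ₚ τ) ⟨$⟩ˡ_) (toℕ x)                ≡⟨ permuteDigits-∘ m (τ ⟨$⟩ˡ_) (ρ ⟨$⟩ˡ_) (toℕ x) (toℕ<n^m x) ⟨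
      permuteDigits m (τ ⟨$⟩ˡ_) (permuteDigits m (ρ ⟨$⟩ˡ_) (toℕ x)) ≡⟨ cong (permuteDigits m (τ ⟨$⟩ˡ_)) (toℕ-permuteIndex _ x) ⟨
      permuteDigits m (τ ⟨$⟩ˡ_) (toℕ (permuteIndex (ρ ⟨$⟩ˡ_) x)) ≡⟨ toℕ-permuteIndex _ _ ⟨
      toℕ (permuteIndex (τ ⟨$⟩ˡ_) (permuteIndex (ρ ⟨$⟩ˡ_) x)) ∎)
      where open ≡-Reasoning

    K⊆image-shuffle : ∀ σ → InK m (λ _ → n) σ → ∃ λ ρ → shuffle ρ ≈ₚ σ
    K⊆image-shuffle σ (gen (ρ , σ-induced)) = ρ , induced≈shuffle ρ σ σ-induced
    K⊆image-shuffle σ one = id , λ x →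
      toℕ-injective (trans (toℕ-permuteIndex _ x) (permuteDigits-id m _ (toℕ x) (λ _ → refl) (toℕ<n^m x)))
    K⊆image-shuffle σ (mul σ₁∈K σ₂∈K) with K⊆image-shuffle _ σ₁∈K | K⊆image-shuffle _ σ₂∈K
    ... | ρ , ρ̃≈σ₁ | τ , τ̃≈σ₂ = ρ ∘ₚ τ , λ x →
      trans (shuffle-∘ ρ τ x) (trans (cong (shuffle τ ⟨$⟩ʳ_) (ρ̃≈σ₁ x)) (τ̃≈σ₂ _))
    K⊆image-shuffle σ (inv {σ₁} σ₁∈K) with K⊆image-shuffle _ σ₁∈K
    ... | ρ , ρ̃≈σ₁ = flip ρ , flip-cong {π = shuffle ρ} {σ₁} ρ̃≈σ₁
    K⊆image-shuffle σ (resp σ₁≈σ σ₁∈K) with K⊆image-shuffle _ σ₁∈K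
    ... | ρ , ρ̃≈σ₁ = ρ , λ x → trans (ρ̃≈σ₁ x) (σ₁≈σ x)

    digits-shuffle : ∀ ρ x t → digits m (toℕ (shuffle ρ ⟨$⟩ʳ x)) t ≡ digits m (toℕ x) (ρ ⟨$⟩ˡ t)
    digits-shuffle ρ x t = trans (cong (λ v → digits m v t) (toℕ-permuteIndex (ρ ⟨$⟩ˡ_) x))
                                 (digits-permuteDigits m _ (toℕ x) (toℕ<n^m x) t)

    oneHot : Fin m → Fin m → ℕ
    oneHot u t = χ (toℕ t ≡ᵇ toℕ u)

    shuffle-injective : 2 ≤ n → ∀ ρ τ → shuffle ρ ≈ₚ shuffle τ → ρ ≈ₚ τ
    shuffle-injective 2≤n ρ τ ρ̃≈τ̃ u = begin
      ρ ⟨$⟩ʳ u                        ≡⟨ inverseʳ τ ⟨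
      τ ⟨$⟩ʳ (τ ⟨$⟩ˡ (ρ ⟨$⟩ʳ u))      ≡⟨ cong (τ ⟨$⟩ʳ_) (toℕ-injective (χ≡1⇒≡ oneHot-at-τ⁻¹ρu)) ⟩
      τ ⟨$⟩ʳ u                        ∎
      where
      open ≡-Reasoning
      oneHot-bounded : Bounded (oneHot u)
      oneHot-bounded t = ≤-trans (s≤s (χ≤1 _)) 2≤n
      xᵤ : Fin N
      xᵤ = index (encode m (oneHot u)) (encode< m (oneHot u) oneHot-bounded)
      digits-xᵤ : ∀ t → digits m (toℕ xᵤ) t ≡ oneHot u t
      digits-xᵤ t = trans (cong (λ v → digits m v t) (toℕ-index _ (encode< m (oneHot u) oneHot-bounded))) (digits-encode m (oneHot u) oneHot-bounded t)
      oneHot-at-τ⁻¹ρu : oneHot u (τ ⟨$⟩ˡ (ρ ⟨$⟩ʳ u)) ≡ 1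
      oneHot-at-τ⁻¹ρu = begin
        oneHot u (τ ⟨$⟩ˡ (ρ ⟨$⟩ʳ u))             ≡⟨ digits-xᵤ _ ⟨
        digits m (toℕ xᵤ) (τ ⟨$⟩ˡ (ρ ⟨$⟩ʳ u))     ≡⟨ digits-shuffle τ xᵤ _ ⟨
        digits m (toℕ (shuffle τ ⟨$⟩ʳ xᵤ)) (ρ ⟨$⟩ʳ u) ≡⟨ cong (λ y → digits m (toℕ y) (ρ ⟨$⟩ʳ u)) (ρ̃≈τ̃ xᵤ) ⟨
        digits m (toℕ (shuffle ρ ⟨$⟩ʳ xᵤ)) (ρ ⟨$⟩ʳ u) ≡⟨ digits-shuffle ρ xᵤ _ ⟩
        digits m (toℕ xᵤ) (ρ ⟨$⟩ˡ (ρ ⟨$⟩ʳ u))     ≡⟨ digits-xᵤ _ ⟩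
        oneHot u (ρ ⟨$⟩ˡ (ρ ⟨$⟩ʳ u))             ≡⟨ cong (oneHot u) (inverseˡ ρ) ⟩
        oneHot u u                                ≡⟨ χ-≡ {toℕ u} refl ⟩
        1                                         ∎

corollary4p6 : (m n : ℕ) → 2 ≤ m → 2 ≤ n →
    SymIso m (InK m (λ _ → n))
corollary4p6 m n _ 2≤n =
  shuffle , (λ ρ → gen (ρ , shuffle-induced ρ)) , K⊆image-shuffle , shuffle-∘ , shuffle-injective 2≤n
  where open Radix.Shuffle n m
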